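{- Let $S\subset\mathbb Z$ be finite and non-empty with diameter $d=\max S-\min S$. Then for every $n>d$, regarding $S$ as a subset of $\mathbb Z_n$ by reduction modulo $n$, \[ \kappa(S,\mathbb Z_n)\le\frac{n+d}{n}\,\kappa(S,\mathbb Z)<2\kappa(S,\mathbb Z). \]
   Context: For finite non-empty $S\subset\mathbb Z$: $\tau(S,N)=\min\{|T|:T\subseteq\mathbb Z,\ T+S\supseteq\{1,\dots,N\}\}$, $\tau(S,\mathbb Z)=\lim_{N\to\infty}\tau(S,N)/N$, $\kappa(S,\mathbb Z)=\tau(S,\mathbb Z)|S|$. For $S\subseteq\mathbb Z_n$: $\tau(S,\mathbb Z_n)=\min\{|T|:T\subseteq\mathbb Z_n,\ T+S=\mathbb Z_n\}$ and $\kappa(S,\mathbb Z_n)=\tau(S,\mathbb Z_n)|S|/n$. -}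

module Defs where

open import Data.Nat as ℕ using (ℕ; suc; NonZero)
open import Data.Integer as ℤ using (ℤ; +_; _⊔_; _⊓_; ∣_∣)
open import Data.Integer.Divisibility using () renaming (_∣_ to _∣ℤ_)
open import Data.Fin using (Fin; toℕ)
open import Data.List using (List; []; _∷_; length; foldr)
open import Data.List.Membership.Propositional using (_∈_)
open import Data.Product using (Σ; ∃; _×_; _,_)
open import Data.Rational as ℚ using (ℚ; _/_)

maxL : ℤ → List ℤ → ℤ
maxL s ss = foldr _⊔_ s ss

minL : ℤ → List ℤ → ℤ
minL s ss = foldr _⊓_ s ss

diam : ℤ → List ℤ → ℕ
diam s ss = ∣ maxL s ss ℤ.- minL s ss ∣

CoversUpTo : List ℤ → List ℤ → ℕ → Set
CoversUpTo S T N = (x : ℕ) → 1 ℕ.≤ x → x ℕ.≤ N →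
  ∃ λ t → ∃ λ s → t ∈ T × s ∈ S × (t ℤ.+ s ≡ + x)
  where open import Relation.Binary.PropositionalEquality using (_≡_)

IsTau : List ℤ → ℕ → ℕ → Set
IsTau S N k =
  (Σ (List ℤ) λ T → length T ≡ k × CoversUpTo S T N) ×
  ((T : List ℤ) → CoversUpTo S T N → k ℕ.≤ length T)
  where open import Relation.Binary.PropositionalEquality using (_≡_)

CoversZn : (n : ℕ) → List ℤ → List (Fin n) → Set
CoversZn n S T = (x : Fin n) →
  ∃ λ t → ∃ λ s → t ∈ T × s ∈ S × ((+ n) ∣ℤ ((+ toℕ t) ℤ.+ s ℤ.- (+ toℕ x)))

IsTauZn : (n : ℕ) → List ℤ → ℕ → Set
IsTauZn n S k =
  (Σ (List (Fin n)) λ T → length T ≡ k × CoversZn n S T) ×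
  ((T : List (Fin n)) → CoversZn n S T → k ℕ.≤ length T)
  where open import Relation.Binary.PropositionalEquality using (_≡_)

-- τ(S, M) · |S| / M  for M = suc N  (the sequence whose limit is κ(S, ℤ))
kappaSeq : (τ : ℕ → ℕ) → (size : ℕ) → ℕ → ℚ
kappaSeq τ size N = (+ (τ (suc N) ℕ.* size)) / suc N

module Submission where

-- Let D = n + d and m = min S, and suppose T + S covers an interval [a, a + qD). Split T at
-- the cut c = a + n - m. A point of [a, a + n) can only be hit from below c, so the part of T
-- below c, reduced mod n, covers ℤ_n; a point of [a + D, a + qD) can only be hit from c or
-- above (as S ⊆ [m, m + d]), so the rest of T covers that shorter interval. By induction
-- |T| ≥ q τ(S, ℤ_n), hence τ(S, ℤ_n) M ≤ (τ(S, ℤ_n) + τ(S, M)) D for every M, and dividing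
-- by n M gives the first inequality up to an error O(1/M). The same bound gives
-- κ(S, M) ≥ 1/(2D) once M ≥ 2D, so the slack (2 - D/n) κ(S, M) ≥ 1/(2nD) is uniform in M.

open import Defs
open import Data.Nat as ℕ using (ℕ; zero; suc; NonZero; _+_; _*_; _<_; _≤_; z≤n; s≤s)
import Data.Nat.Properties as ℕP
import Data.Nat.DivMod as ℕDM
open import Data.Nat.Tactic.RingSolver using () renaming (solve-∀ to ℕ-solve-∀)
open import Data.Nat.Divisibility using (_∣_; n∣m*n)
open import Data.Integer as ℤ using (ℤ; +_; +[1+_]; 0ℤ; +<+; +≤+)
import Data.Integer.Properties as ℤP
import Data.Integer.DivMod as ℤDM
open import Data.Integer.Divisibility using () renaming (_∣_ to _∣ℤ_)
open import Data.Integer.Tactic.RingSolver using () renaming (solve-∀ to ℤ-solve-∀)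
open import Data.Rational as ℚ using (ℚ; _/_; Positive; mkℚ; toℚᵘ)
import Data.Rational.Properties as ℚP
open import Data.Rational.Unnormalised as ℚᵘ using (mkℚᵘ; *≤*)
import Data.Rational.Unnormalised.Properties as ℚᵘP
open import Data.Fin as Fin using (Fin; toℕ; fromℕ<)
import Data.Fin.Properties as FinP
open import Data.List using (List; []; _∷_; length; filter; map)
open import Data.List.Properties using (length-map)
open import Data.List.Membership.Propositional using (_∈_)
open import Data.List.Relation.Unary.Unique.Propositional using (Unique)
open import Data.List.Membership.Propositional.Properties using (∈-filter⁺; ∈-map⁺)
open import Data.List.Relation.Unary.Any using (here; there)
open import Data.Product using (∃; ∃₂; _×_; _,_)
open import Function using (_∘_)
open import Level using (0ℓ)
open import Relation.Nullary using (Dec; ¬?; yes; no)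
open import Relation.Unary using (Pred; Decidable)
open import Relation.Binary.PropositionalEquality

minL-≤ : ∀ s ss {x} → x ∈ s ∷ ss → minL s ss ℤ.≤ x
minL-≤ s []       (here refl)         = ℤP.≤-refl
minL-≤ s (y ∷ ys) (here refl)         = ℤP.≤-trans (ℤP.i⊓j≤j y _) (minL-≤ s ys (here refl))
minL-≤ s (y ∷ ys) (there (here refl)) = ℤP.i⊓j≤i y _
minL-≤ s (y ∷ ys) (there (there x∈)) = ℤP.≤-trans (ℤP.i⊓j≤j y _) (minL-≤ s ys (there x∈))

≤-maxL : ∀ s ss {x} → x ∈ s ∷ ss → x ℤ.≤ maxL s ss
≤-maxL s []       (here refl)         = ℤP.≤-refl
≤-maxL s (y ∷ ys) (here refl)         = ℤP.≤-trans (≤-maxL s ys (here refl)) (ℤP.i≤j⊔i y _)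
≤-maxL s (y ∷ ys) (there (here refl)) = ℤP.i≤i⊔j y _
≤-maxL s (y ∷ ys) (there (there x∈)) = ℤP.≤-trans (≤-maxL s ys (there x∈)) (ℤP.i≤j⊔i y _)

maxL≡minL+diam : ∀ s ss → maxL s ss ≡ minL s ss ℤ.+ + diam s ss
maxL≡minL+diam s ss = begin
  maxL s ss                               ≡⟨ i≡j+[i-j] (maxL s ss) (minL s ss) ⟩
  minL s ss ℤ.+ (maxL s ss ℤ.- minL s ss) ≡⟨ cong (λ i → minL s ss ℤ.+ i) (ℤP.0≤i⇒+∣i∣≡i 0≤max-min) ⟨
  minL s ss ℤ.+ + diam s ss               ∎
  where
  open ≡-Reasoning
  i≡j+[i-j] : ∀ i j → i ≡ j ℤ.+ (i ℤ.- j)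
  i≡j+[i-j] = ℤ-solve-∀
  0≤max-min : 0ℤ ℤ.≤ maxL s ss ℤ.- minL s ss
  0≤max-min = ℤP.i≤j⇒0≤j-i (ℤP.≤-trans (minL-≤ s ss (here refl)) (≤-maxL s ss (here refl)))

≤-minL+diam : ∀ s ss {x} → x ∈ s ∷ ss → x ℤ.≤ minL s ss ℤ.+ + diam s ss
≤-minL+diam s ss x∈ = subst (_ ℤ.≤_) (maxL≡minL+diam s ss) (≤-maxL s ss x∈)

CoversInterval : List ℤ → List ℤ → ℤ → ℕ → Set
CoversInterval S T a L = ∀ k → k < L → ∃₂ λ t x → t ∈ T × x ∈ S × t ℤ.+ x ≡ a ℤ.+ + k

CoversUpTo⇒CoversInterval : ∀ {S T M L} → CoversUpTo S T M → L ≤ M → CoversInterval S T (+ 1) L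
CoversUpTo⇒CoversInterval cov L≤M k k<L = cov (suc k) (s≤s z≤n) (ℕP.≤-trans k<L L≤M)

length-filter+length-filter-¬ : ∀ {A : Set} {P : Pred A 0ℓ} (P? : Decidable P) xs →
  length (filter P? xs) + length (filter (¬? ∘ P?) xs) ≡ length xs
length-filter+length-filter-¬ P? [] = refl
length-filter+length-filter-¬ P? (x ∷ xs) with P? x
... | yes _ = cong suc (length-filter+length-filter-¬ P? xs)
... | no  _ = trans (ℕP.+-suc _ _) (cong suc (length-filter+length-filter-¬ P? xs))

below-cut : ∀ a {t x m} k {n} → t ℤ.+ x ≡ a ℤ.+ + k → k < n → m ℤ.≤ x →
  t ℤ.< a ℤ.+ + n ℤ.- m
below-cut a {t} {x} {m} k {n} t+x≡a+k k<n m≤x = begin-strict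
  t               ≡⟨ i≡i+j-j t m ⟩
  t ℤ.+ m ℤ.- m   ≤⟨ ℤP.+-monoˡ-≤ (ℤ.- m) (ℤP.+-monoʳ-≤ t m≤x) ⟩
  t ℤ.+ x ℤ.- m   ≡⟨ cong (ℤ._- m) t+x≡a+k ⟩
  a ℤ.+ + k ℤ.- m <⟨ ℤP.+-monoˡ-< (ℤ.- m) (ℤP.+-monoʳ-< a (+<+ k<n)) ⟩
  a ℤ.+ + n ℤ.- m ∎
  where
  open ℤP.≤-Reasoning
  i≡i+j-j : ∀ i j → i ≡ i ℤ.+ j ℤ.- j
  i≡i+j-j = ℤ-solve-∀

above-cut : ∀ a {t x m} n d k → t ℤ.+ x ≡ a ℤ.+ + (n + d + k) → x ℤ.≤ m ℤ.+ + d →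
  a ℤ.+ + n ℤ.- m ℤ.≤ t
above-cut a {t} {x} {m} n d k t+x≡a+D+k x≤m+d = begin
  a ℤ.+ + n ℤ.- m                     ≡⟨ shift a m (+ n) (+ d) ⟩
  a ℤ.+ (+ n ℤ.+ + d) ℤ.- (m ℤ.+ + d) ≡⟨ cong (λ i → a ℤ.+ i ℤ.- (m ℤ.+ + d)) (ℤP.pos-+ n d) ⟨
  a ℤ.+ + (n + d) ℤ.- (m ℤ.+ + d)     ≤⟨ ℤP.+-monoˡ-≤ (ℤ.- (m ℤ.+ + d)) (ℤP.+-monoʳ-≤ a (+≤+ (ℕP.m≤m+n _ k))) ⟩
  a ℤ.+ + (n + d + k) ℤ.- (m ℤ.+ + d) ≡⟨ cong (ℤ._- (m ℤ.+ + d)) (sym t+x≡a+D+k) ⟩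
  t ℤ.+ x ℤ.- (m ℤ.+ + d)             ≤⟨ ℤP.+-monoʳ-≤ (t ℤ.+ x) (ℤP.neg-mono-≤ x≤m+d) ⟩
  t ℤ.+ x ℤ.- x                       ≡⟨ i+j-j≡i t x ⟩
  t                                   ∎
  where
  open ℤP.≤-Reasoning
  shift : ∀ a m i j → a ℤ.+ i ℤ.- m ≡ a ℤ.+ (i ℤ.+ j) ℤ.- (m ℤ.+ j)
  shift = ℤ-solve-∀
  i+j-j≡i : ∀ i j → i ℤ.+ j ℤ.- j ≡ i
  i+j-j≡i = ℤ-solve-∀

residue : ∀ n .{{_ : NonZero n}} → ℤ → Fin n
residue n t = fromℕ< (ℤDM.n%ℕd<d t n)

n∣ℤi*n : ∀ i n → + n ∣ℤ i ℤ.* + n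
n∣ℤi*n i n = subst (n ∣_) (sym (ℤP.abs-* i (+ n))) (n∣m*n ℤ.∣ i ∣)

residue-+-≡-mod : ∀ n .{{_ : NonZero n}} a {t x} X → t ℤ.+ x ≡ a ℤ.+ + ((X ℤ.- a) ℤ.%ℕ n) →
  + n ∣ℤ (+ toℕ (residue n t) ℤ.+ x ℤ.- X)
residue-+-≡-mod n a {t} {x} X t+x≡a+k = subst (+ n ∣ℤ_) (sym difference) (n∣ℤi*n (ℤ.- (u ℤ.+ v)) n)
  where
  open ≡-Reasoning
  k : ℕ
  k = (X ℤ.- a) ℤ.%ℕ n
  u v : ℤ
  u = (X ℤ.- a) ℤ./ℕ n
  v = t ℤ./ℕ n
  difference : + toℕ (residue n t) ℤ.+ x ℤ.- X ≡ ℤ.- (u ℤ.+ v) ℤ.* + n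
  difference = begin
    + toℕ (residue n t) ℤ.+ x ℤ.- X
      ≡⟨ cong (λ r → + r ℤ.+ x ℤ.- X) (FinP.toℕ-fromℕ< (ℤDM.n%ℕd<d t n)) ⟩
    + (t ℤ.%ℕ n) ℤ.+ x ℤ.- X
      ≡⟨ regroup (+ (t ℤ.%ℕ n)) v (+ n) x X a ⟩
    (+ (t ℤ.%ℕ n) ℤ.+ v ℤ.* + n ℤ.+ x) ℤ.- v ℤ.* + n ℤ.- (X ℤ.- a ℤ.+ a)
      ≡⟨ cong (λ i → i ℤ.+ x ℤ.- v ℤ.* + n ℤ.- (X ℤ.- a ℤ.+ a)) (ℤDM.a≡a%ℕn+[a/ℕn]*n t n) ⟨
    (t ℤ.+ x) ℤ.- v ℤ.* + n ℤ.- (X ℤ.- a ℤ.+ a)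
      ≡⟨ cong₂ (λ i j → i ℤ.- v ℤ.* + n ℤ.- (j ℤ.+ a)) t+x≡a+k (ℤDM.a≡a%ℕn+[a/ℕn]*n (X ℤ.- a) n) ⟩
    (a ℤ.+ + k) ℤ.- v ℤ.* + n ℤ.- (+ k ℤ.+ u ℤ.* + n ℤ.+ a)
      ≡⟨ cancel a (+ k) u v (+ n) ⟩
    ℤ.- (u ℤ.+ v) ℤ.* + n ∎
    where
    regroup : ∀ r v n x X a → r ℤ.+ x ℤ.- X ≡ (r ℤ.+ v ℤ.* n ℤ.+ x) ℤ.- v ℤ.* n ℤ.- (X ℤ.- a ℤ.+ a)
    regroup = ℤ-solve-∀
    cancel : ∀ a k u v n → (a ℤ.+ k) ℤ.- v ℤ.* n ℤ.- (k ℤ.+ u ℤ.* n ℤ.+ a) ≡ ℤ.- (u ℤ.+ v) ℤ.* n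
    cancel = ℤ-solve-∀

module BlockDecomposition (s : ℤ) (ss : List ℤ) (n : ℕ) .{{_ : NonZero n}} where

  private
    S : List ℤ
    S = s ∷ ss
    D : ℕ
    D = n + diam s ss

  cut : ℤ → ℤ
  cut a = a ℤ.+ + n ℤ.- minL s ss

  lowerPart-coversZn : ∀ a {L T} → n ≤ L → CoversInterval S T a L →
    CoversZn n S (map (residue n) (filter (ℤ._<? cut a) T))
  lowerPart-coversZn a n≤L cov x
    with cov ((+ toℕ x ℤ.- a) ℤ.%ℕ n) (ℕP.<-≤-trans (ℤDM.n%ℕd<d (+ toℕ x ℤ.- a) n) n≤L)
  ... | t , y , t∈T , y∈S , t+y≡a+k =
    residue n t , y , ∈-map⁺ (residue n) (∈-filter⁺ (ℤ._<? cut a) t∈T t<cut) , y∈S ,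
    residue-+-≡-mod n a {t} {y} (+ toℕ x) t+y≡a+k
    where
    t<cut : t ℤ.< cut a
    t<cut = below-cut a _ t+y≡a+k (ℤDM.n%ℕd<d (+ toℕ x ℤ.- a) n) (minL-≤ s ss y∈S)

  upperPart-covers : ∀ a {L T} → CoversInterval S T a (D + L) →
    CoversInterval S (filter (¬? ∘ (ℤ._<? cut a)) T) (a ℤ.+ + D) L
  upperPart-covers a cov k k<L with cov (D + k) (ℕP.+-monoʳ-< D k<L)
  ... | t , y , t∈T , y∈S , t+y≡a+D+k =
    t , y , ∈-filter⁺ (¬? ∘ (ℤ._<? cut a)) t∈T (ℤP.≤⇒≯ cut≤t) , y∈S ,
    trans t+y≡a+D+k (sym (ℤP.+-assoc a (+ D) (+ k)))
    where
    cut≤t : cut a ℤ.≤ t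
    cut≤t = above-cut a n (diam s ss) k t+y≡a+D+k (≤-minL+diam s ss y∈S)

  module _ {τn : ℕ} (τn-minimal : ∀ T → CoversZn n S T → τn ≤ length T) where

    length-lowerBound : ∀ q a {T} → CoversInterval S T a (q * D) → q * τn ≤ length T
    length-lowerBound zero    _ _ = z≤n
    length-lowerBound (suc q) a {T} cov = begin
      τn + q * τn                                                ≤⟨ ℕP.+-mono-≤ lower upper ⟩
      length (filter below? T) + length (filter (¬? ∘ below?) T) ≡⟨ length-filter+length-filter-¬ below? T ⟩
      length T                                                   ∎
      where
      open ℕP.≤-Reasoning
      below? : ∀ t → Dec (t ℤ.< cut a)
      below? = ℤ._<? cut a
      lower : τn ≤ length (filter below? T)
      lower = ℕP.≤-trans (τn-minimal _ (lowerPart-coversZn a (ℕP.≤-trans (ℕP.m≤m+n n _) (ℕP.m≤m+n D _)) cov))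
                         (ℕP.≤-reflexive (length-map (residue n) (filter below? T)))
      upper : q * τn ≤ length (filter (¬? ∘ below?) T)
      upper = length-lowerBound q (a ℤ.+ + D) (upperPart-covers a cov)

    τ-lowerBound : ∀ {M τM} q → IsTau S M τM → q * D ≤ M → q * τn ≤ τM
    τ-lowerBound q ((T , |T|≡τM , cov) , _) qD≤M =
      subst (_ ≤_) |T|≡τM (length-lowerBound q (+ 1) (CoversUpTo⇒CoversInterval cov qD≤M))

CoversZn-nonempty : ∀ {n S} T → CoversZn (suc n) S T → 0 < length T
CoversZn-nonempty []      cov with cov Fin.zero
... | _ , _ , () , _
CoversZn-nonempty (_ ∷ _) _ = s≤s z≤n

BlockBound : ℕ → (ℕ → ℕ) → ℕ → Set
BlockBound τn τ D = ∀ M → τn * M ≤ (τn + τ M) * D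

t*M≤[t+C]*D : ∀ t M D C .{{_ : NonZero D}} → (M ℕ./ D) * t ≤ C → t * M ≤ (t + C) * D
t*M≤[t+C]*D t M D C q*t≤C = begin
  t * M                             ≡⟨ cong (t *_) (ℕDM.m≡m%n+[m/n]*n M D) ⟩
  t * (M ℕ.% D + M ℕ./ D * D)       ≡⟨ distribute t (M ℕ.% D) (M ℕ./ D) D ⟩
  t * (M ℕ.% D) + (M ℕ./ D * t) * D ≤⟨ ℕP.+-mono-≤ (ℕP.*-monoʳ-≤ t (ℕP.<⇒≤ (ℕDM.m%n<n M D)))
                                                    (ℕP.*-monoˡ-≤ D q*t≤C) ⟩
  t * D + C * D                     ≡⟨ ℕP.*-distribʳ-+ D t C ⟨
  (t + C) * D                       ∎
  where
  open ℕP.≤-Reasoning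
  distribute : ∀ t r q D → t * (r + q * D) ≡ t * r + (q * t) * D
  distribute = ℕ-solve-∀

M≤2*C*D : ∀ t M C D .{{_ : NonZero t}} → 2 * D ≤ M → t * M ≤ (t + C) * D → M ≤ 2 * C * D
M≤2*C*D t M C D 2D≤M tM≤[t+C]D = ℕP.≤-trans (ℕP.m≤n*m M t) (ℕP.+-cancelˡ-≤ (t * M) _ _ (begin
  t * M + t * M             ≤⟨ ℕP.+-mono-≤ tM≤[t+C]D tM≤[t+C]D ⟩
  (t + C) * D + (t + C) * D ≡⟨ double t C D ⟩
  t * (2 * D) + 2 * C * D   ≤⟨ ℕP.+-monoˡ-≤ (2 * C * D) (ℕP.*-monoʳ-≤ t 2D≤M) ⟩
  t * M + 2 * C * D         ∎))
  where
  open ℕP.≤-Reasoning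
  double : ∀ t C D → (t + C) * D + (t + C) * D ≡ t * (2 * D) + 2 * C * D
  double = ℕ-solve-∀

private
  toℚᵘ-/ : ∀ a b → toℚᵘ (+ a / suc b) ℚᵘ.≃ mkℚᵘ (+ a) b
  toℚᵘ-/ a b = ℚP.toℚᵘ-fromℚᵘ (mkℚᵘ (+ a) b)

*≤*⇒/≤/ : ∀ a b c e .{{_ : NonZero b}} .{{_ : NonZero e}} → a * e ≤ c * b → + a / b ℚ.≤ + c / e
*≤*⇒/≤/ a (suc b) c (suc e) ae≤cb = ℚP.toℚᵘ-cancel-≤
  (ℚᵘP.≤-respˡ-≃ (ℚᵘP.≃-sym (toℚᵘ-/ a b)) (ℚᵘP.≤-respʳ-≃ (ℚᵘP.≃-sym (toℚᵘ-/ c e))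
    (*≤* (subst₂ ℤ._≤_ (ℤP.pos-* a (suc e)) (ℤP.pos-* c (suc b)) (+≤+ ae≤cb)))))

/*/≡/ : ∀ a b c e → (+ a / suc b) ℚ.* (+ c / suc e) ≡ + (a * c) / (suc b * suc e)
/*/≡/ a b c e = ℚP.toℚᵘ-injective (begin
  toℚᵘ ((+ a / suc b) ℚ.* (+ c / suc e))     ≈⟨ ℚP.toℚᵘ-homo-* (+ a / suc b) (+ c / suc e) ⟩
  toℚᵘ (+ a / suc b) ℚᵘ.* toℚᵘ (+ c / suc e) ≈⟨ ℚᵘP.*-cong (toℚᵘ-/ a b) (toℚᵘ-/ c e) ⟩
  mkℚᵘ (+ a ℤ.* + c) (e + b * suc e)         ≡⟨ cong (λ i → mkℚᵘ i (e + b * suc e)) (ℤP.pos-* a c) ⟨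
  mkℚᵘ (+ (a * c)) (e + b * suc e)           ≈⟨ toℚᵘ-/ (a * c) (e + b * suc e) ⟨
  toℚᵘ (+ (a * c) / (suc b * suc e))         ∎)
  where open ℚᵘP.≃-Reasoning

/+/≡/ : ∀ a b c e →
  (+ a / suc b) ℚ.+ (+ c / suc e) ≡ + (a * suc e + c * suc b) / (suc b * suc e)
/+/≡/ a b c e = ℚP.toℚᵘ-injective (begin
  toℚᵘ ((+ a / suc b) ℚ.+ (+ c / suc e))     ≈⟨ ℚP.toℚᵘ-homo-+ (+ a / suc b) (+ c / suc e) ⟩
  toℚᵘ (+ a / suc b) ℚᵘ.+ toℚᵘ (+ c / suc e) ≈⟨ ℚᵘP.+-cong (toℚᵘ-/ a b) (toℚᵘ-/ c e) ⟩
  mkℚᵘ (+ a ℤ.* + suc e ℤ.+ + c ℤ.* + suc b) (e + b * suc e)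
    ≡⟨ cong (λ i → mkℚᵘ i (e + b * suc e)) numerator ⟨
  mkℚᵘ (+ (a * suc e + c * suc b)) (e + b * suc e)
    ≈⟨ toℚᵘ-/ (a * suc e + c * suc b) (e + b * suc e) ⟨
  toℚᵘ (+ (a * suc e + c * suc b) / (suc b * suc e)) ∎)
  where
  open ℚᵘP.≃-Reasoning
  numerator : + (a * suc e + c * suc b) ≡ + a ℤ.* + suc e ℤ.+ + c ℤ.* + suc b
  numerator = trans (ℤP.pos-+ (a * suc e) (c * suc b))
                    (cong₂ ℤ._+_ (ℤP.pos-* a (suc e)) (ℤP.pos-* c (suc b)))

private
  cross-multiplied-upper : ∀ t k n M Q C D e → t * M ≤ (t + C) * D → t * D * k * Q ≤ e →
    t * k * (n * M * Q) ≤ (D * (C * k) * Q + e) * n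
  cross-multiplied-upper t k n M Q C D e tM≤[t+C]D error≤e = begin
    t * k * (n * M * Q)                   ≡⟨ regroup₁ t k n M Q ⟩
    t * M * (k * Q * n)                   ≤⟨ ℕP.*-monoˡ-≤ (k * Q * n) tM≤[t+C]D ⟩
    (t + C) * D * (k * Q * n)             ≡⟨ regroup₂ t C D k Q n ⟩
    (t * D * k * Q + D * (C * k) * Q) * n ≤⟨ ℕP.*-monoˡ-≤ n (ℕP.+-monoˡ-≤ _ error≤e) ⟩
    (e + D * (C * k) * Q) * n             ≡⟨ cong (_* n) (ℕP.+-comm e _) ⟩
    (D * (C * k) * Q + e) * n             ∎
    where
    open ℕP.≤-Reasoning
    regroup₁ : ∀ t k n M Q → t * k * (n * M * Q) ≡ t * M * (k * Q * n)
    regroup₁ = ℕ-solve-∀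
    regroup₂ : ∀ t C D k Q n →
      (t + C) * D * (k * Q * n) ≡ (t * D * k * Q + D * (C * k) * Q) * n
    regroup₂ = ℕ-solve-∀

blockBound⇒κₙ≤[D/n]κ+ε : ∀ n₀ D k τn (τ : ℕ → ℕ) → BlockBound τn τ D →
  (ε : ℚ) → Positive ε → ∃ λ N₀ → ∀ N → N₀ ≤ N →
    + (τn * k) / suc n₀ ℚ.≤ (+ D / suc n₀) ℚ.* kappaSeq τ k N ℚ.+ ε
-- Writing ε = p/q, the error term τn k D / (n M) is at most 1/q ≤ ε once M ≥ τn D k q.
blockBound⇒κₙ≤[D/n]κ+ε n₀ D k τn τ blockBound ε@(mkℚ +[1+ p ] Q _) _ = τn * D * k * suc Q , bound
  where
  n : ℕ
  n = suc n₀
  bound : ∀ N → τn * D * k * suc Q ≤ N →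
    + (τn * k) / n ℚ.≤ (+ D / n) ℚ.* kappaSeq τ k N ℚ.+ ε
  bound N N₀≤N = begin
    + (τn * k) / n
      ≤⟨ *≤*⇒/≤/ (τn * k) n (D * (C * k) * suc Q + e) (n * M * suc Q)
           (cross-multiplied-upper τn k n M (suc Q) C D e (blockBound M) error≤e) ⟩
    + (D * (C * k) * suc Q + e) / (n * M * suc Q)
      ≡⟨ /+/≡/ (D * (C * k)) (ℕ.pred (n * M)) (suc p) Q ⟨
    + (D * (C * k)) / (n * M) ℚ.+ + suc p / suc Q
      ≡⟨ cong₂ ℚ._+_ (sym (/*/≡/ D n₀ (C * k) N)) (ℚP.↥p/↧p≡p ε) ⟩
    (+ D / n) ℚ.* kappaSeq τ k N ℚ.+ ε ∎
    where
    open ℚP.≤-Reasoning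
    M C e : ℕ
    M = suc N
    C = τ M
    e = suc p * (n * M)
    error≤e : τn * D * k * suc Q ≤ e
    error≤e = ℕP.≤-trans N₀≤N (ℕP.≤-trans (ℕP.n≤1+n N) (ℕP.≤-trans (ℕP.m≤n*m M n) (ℕP.m≤n*m (n * M) (suc p))))

private
  cross-multiplied-gap : ∀ X n D M → suc D ≤ 2 * n → M ≤ 2 * X * D →
    (D * X * (2 * n * D) + 1 * (n * M)) * (1 * M) ≤ 2 * X * (n * M * (2 * n * D))
  cross-multiplied-gap X n D M D<2n M≤2XD = begin
    (D * X * (2 * n * D) + 1 * (n * M)) * (1 * M) ≡⟨ regroup₁ D X n M ⟩
    M * (2 * n * D * X * D + n * M)
      ≤⟨ ℕP.*-monoʳ-≤ M (ℕP.+-monoʳ-≤ (2 * n * D * X * D) (ℕP.*-monoʳ-≤ n M≤2XD)) ⟩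
    M * (2 * n * D * X * D + n * (2 * X * D)) ≡⟨ regroup₂ M n D X ⟩
    M * (2 * n * D * X * suc D)               ≤⟨ ℕP.*-monoʳ-≤ M (ℕP.*-monoʳ-≤ (2 * n * D * X) D<2n) ⟩
    M * (2 * n * D * X * (2 * n))             ≡⟨ regroup₃ M n D X ⟩
    2 * X * (n * M * (2 * n * D))             ∎
    where
    open ℕP.≤-Reasoning
    regroup₁ : ∀ D X n M →
      (D * X * (2 * n * D) + 1 * (n * M)) * (1 * M) ≡ M * (2 * n * D * X * D + n * M)
    regroup₁ = ℕ-solve-∀
    regroup₂ : ∀ M n D X →
      M * (2 * n * D * X * D + n * (2 * X * D)) ≡ M * (2 * n * D * X * suc D)
    regroup₂ = ℕ-solve-∀
    regroup₃ : ∀ M n D X → M * (2 * n * D * X * (2 * n)) ≡ 2 * X * (n * M * (2 * n * D))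
    regroup₃ = ℕ-solve-∀

blockBound⇒[D/n]κ+δ≤2κ : ∀ n₀ d k τn (τ : ℕ → ℕ) .{{_ : NonZero k}} .{{_ : NonZero τn}} → d < suc n₀ →
  BlockBound τn τ (suc n₀ + d) →
  ∃ λ δ → Positive δ × ∃ λ N₀ → ∀ N → N₀ ≤ N →
    (+ (suc n₀ + d) / suc n₀) ℚ.* kappaSeq τ k N ℚ.+ δ ℚ.≤ (+ 2 / 1) ℚ.* kappaSeq τ k N
blockBound⇒[D/n]κ+δ≤2κ n₀ d k τn τ d<n blockBound =
  + 1 / (2 * n * D) , ℚP.normalize-pos 1 (2 * n * D) , 2 * D , bound
  where
  n D : ℕ
  n = suc n₀
  D = n + d
  D<2n : suc D ≤ 2 * n
  D<2n = ℕP.≤-trans (ℕP.≤-reflexive (sym (ℕP.+-suc n d)))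
                    (ℕP.+-monoʳ-≤ n (ℕP.≤-trans d<n (ℕP.≤-reflexive (sym (ℕP.+-identityʳ n)))))
  bound : ∀ N → 2 * D ≤ N →
    (+ D / n) ℚ.* kappaSeq τ k N ℚ.+ + 1 / (2 * n * D) ℚ.≤ (+ 2 / 1) ℚ.* kappaSeq τ k N
  bound N 2D≤N = begin
    (+ D / n) ℚ.* kappaSeq τ k N ℚ.+ + 1 / (2 * n * D)
      ≡⟨ cong (ℚ._+ + 1 / (2 * n * D)) (/*/≡/ D n₀ X N) ⟩
    + (D * X) / (n * M) ℚ.+ + 1 / (2 * n * D)
      ≡⟨ /+/≡/ (D * X) (ℕ.pred (n * M)) 1 (ℕ.pred (2 * n * D)) ⟩
    + (D * X * (2 * n * D) + 1 * (n * M)) / (n * M * (2 * n * D))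
      ≤⟨ *≤*⇒/≤/ (D * X * (2 * n * D) + 1 * (n * M)) (n * M * (2 * n * D)) (2 * X) (1 * M)
                 (cross-multiplied-gap X n D M D<2n M≤2XD) ⟩
    + (2 * X) / (1 * M)
      ≡⟨ /*/≡/ 2 0 X N ⟨
    (+ 2 / 1) ℚ.* kappaSeq τ k N ∎
    where
    open ℚP.≤-Reasoning
    M X : ℕ
    M = suc N
    X = τ M * k
    M≤2XD : M ≤ 2 * X * D
    M≤2XD = ℕP.≤-trans (M≤2*C*D τn M (τ M) D (ℕP.≤-trans 2D≤N (ℕP.n≤1+n N)) (blockBound M))
                       (ℕP.*-monoˡ-≤ D (ℕP.*-monoʳ-≤ 2 (ℕP.m≤m*n (τ M) k)))

lemma6p5 : (s : ℤ) (ss : List ℤ) → Unique (s ∷ ss) →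
    (τ : ℕ → ℕ) → ((N : ℕ) → IsTau (s ∷ ss) N (τ N)) →
    (n : ℕ) → .{{_ : NonZero n}} → diam s ss < n →
    (τn : ℕ) → IsTauZn n (s ∷ ss) τn →
    ((ε : ℚ) → Positive ε → ∃ λ N₀ → (N : ℕ) → N₀ ≤ N →
    (+ (τn ℕ.* length (s ∷ ss))) / n
    ℚ.≤ ((+ (n ℕ.+ diam s ss)) / n) ℚ.* kappaSeq τ (length (s ∷ ss)) N ℚ.+ ε)
    ×
    (∃ λ δ → Positive δ × ∃ λ N₀ → (N : ℕ) → N₀ ≤ N →
    ((+ (n ℕ.+ diam s ss)) / n) ℚ.* kappaSeq τ (length (s ∷ ss)) N ℚ.+ δ
    ℚ.≤ (+ 2 / 1) ℚ.* kappaSeq τ (length (s ∷ ss)) N)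
lemma6p5 s ss _ τ isτ (suc n₀) d<n τn ((T₀ , |T₀|≡τn , T₀-covers) , τn-minimal) =
  blockBound⇒κₙ≤[D/n]κ+ε n₀ D k τn τ blockBound ,
  blockBound⇒[D/n]κ+δ≤2κ n₀ (diam s ss) k τn τ d<n blockBound
  where
  D k : ℕ
  D = suc n₀ + diam s ss
  k = length (s ∷ ss)
  blockBound : BlockBound τn τ D
  blockBound M = t*M≤[t+C]*D τn M D (τ M)
    (BlockDecomposition.τ-lowerBound s ss (suc n₀) τn-minimal (M ℕ./ D) (isτ M) (ℕDM.m/n*n≤m M D))
  instance
    τn≢0 : NonZero τn
    τn≢0 = ℕ.>-nonZero (subst (0 <_) |T₀|≡τn (CoversZn-nonempty T₀ T₀-covers))
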